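{- Let $A$ be a commutative ring with identity and $G$ a subgroup of the group $A^\times$ of units of $A$. Let $A/G=\{[a]:a\in A\}$ be the set of equivalence classes for $a\sim b\iff a=gb$ for some $g\in G$, with hyperaddition $[a]\oplus[b]=\{[c]: c=g_1a+g_2b \text{ for some } g_1,g_2\in G\}$. Then the hypergroup $(A/G,\oplus)$ is realizable.
   Context: A hypergroup is a nonempty set $H$ with a hyperoperation $*$ from $H\times H$ to nonempty subsets of $H$ (extended to subsets by unions) which is associative, has a unique identity $e$ ($e*x=x*e=\{x\}$), unique inverses ($e\in(f^{ -1}*f)\cap(f*f^{ -1})$), and is reversible ($c\in a*b\Rightarrow a\in c*b^{ -1}$ and $b\in a^{ -1}*c$); $(A/G,\oplus)$ is a commutative hypergroup with identity $[0]$. An isomorphism of hypergroups is a bijection $f$ with $f(a*b)=f(a)*f(b)$. For a nonempty set $X$: $1_X$ is the diagonal, $p^*=\{(a,b):(b,a)\in p\}$, $xp=\{y:(x,y)\in p\}$. An association scheme on $X$ is a partition $S$ of $X\times X$ with $1_X\in S$, closed under $p\mapsto p^*$, such that for all $p,q,r\in S$ there is a cardinal $a_{pq}^r$ with $|yp\cap zq^*|=a_{pq}^r$ for all $y\in X$, $z\in yr$. $\mathbf{H}(S)$ is the hypergroup on $S$ with hyperoperation $p*q=\{r\in S:a_{pq}^r\ge1\}$ and identity $1_X$. A hypergroup is realizable if it is isomorphic to $\mathbf{H}(S)$ for some association scheme $S$. -}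

module Defs where

open import Level using (Level; _⊔_; suc)
open import Algebra.Bundles using (CommutativeRing)
open import Relation.Binary.Bundles using (Setoid)
open import Relation.Binary.Core using (Rel)
open import Relation.Binary.Structures using (IsEquivalence)
open import Relation.Unary using (Pred)
open import Data.Product using (Σ; ∃; ∃₂; _×_; _,_; proj₁)
open import Function.Bundles using (Inverse; _⇔_)

record IsUnitSubgroup {c ℓ} (A : CommutativeRing c ℓ)
                      (G : Pred (CommutativeRing.Carrier A) (c ⊔ ℓ)) : Set (c ⊔ ℓ) where
  open CommutativeRing A
  field
    G-resp : ∀ {x y} → x ≈ y → G x → G y
    G-one  : G 1#
    G-mul  : ∀ {x y} → G x → G y → G (x * y)
    G-inv  : ∀ {x} → G x → ∃ λ y → G y × (x * y ≈ 1#)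

-- The hyperstructure (A/G, ⊕), presented on representatives:
--   a ∼ b  iff  a = g b for some g ∈ G   (so [a] = [b])
--   c ∈ a ⊕ b  iff  [c] ∈ [a] ⊕ [b], i.e. c ∼ g₁ a + g₂ b for some g₁,g₂ ∈ G

module QuotientHyper {c ℓ} (A : CommutativeRing c ℓ)
                     (G : Pred (CommutativeRing.Carrier A) (c ⊔ ℓ)) where
  open CommutativeRing A

  _∼_ : Carrier → Carrier → Set (c ⊔ ℓ)
  a ∼ b = ∃ λ g → G g × (a ≈ g * b)

  HAdd : Carrier → Carrier → Carrier → Set (c ⊔ ℓ)
  HAdd x a b = ∃₂ λ g₁ g₂ → G g₁ × G g₂ × (x ∼ ((g₁ * a) + (g₂ * b)))

subSetoid : ∀ {a b p} (X : Setoid a b) → Pred (Setoid.Carrier X) p → Setoid (a ⊔ p) b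
subSetoid X P = record
  { Carrier = Σ (Setoid.Carrier X) P
  ; _≈_ = λ u v → Setoid._≈_ X (proj₁ u) (proj₁ v)
  ; isEquivalence = record
      { refl = Setoid.refl X
      ; sym = Setoid.sym X
      ; trans = Setoid.trans X }
  }

-- The partition S of X × X is given by an index setoid Cls together with
-- the map cls sending (x , y) to the part containing it; the part indexed
-- by r is { (x , y) : cls x y ≈ r }.  Surjectivity makes every part
-- nonempty, and distinct (non-≈) indices give disjoint parts.

record AssociationScheme {a b} (X : Setoid a b) (s t : Level)
       : Set (a ⊔ b ⊔ suc (s ⊔ t)) where
  module X = Setoid X
  field
    Cls      : Setoid s t
  module C = Setoid Cls
  field
    point    : X.Carrier
    cls      : X.Carrier → X.Carrier → C.Carrier
    cls-cong : ∀ {x x′ y y′} → x X.≈ x′ → y X.≈ y′ → cls x y C.≈ cls x′ y′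
    cls-surj : ∀ r → ∃₂ λ x y → cls x y C.≈ r
    diag     : C.Carrier
    diag-spec : ∀ x y → (cls x y C.≈ diag) ⇔ (x X.≈ y)
    star     : ∀ p → ∃ λ p* → ∀ x y → (cls y x C.≈ p) ⇔ (cls x y C.≈ p*)
    -- intersection numbers: |y p ∩ z q*| is the same cardinal for all
    -- (y , z) ∈ r.  Here y p ∩ z q* = { x : (y , x) ∈ p , (x , z) ∈ q }.
    regular  : ∀ p q r y z y′ z′ → cls y z C.≈ r → cls y′ z′ C.≈ r →
               Inverse (subSetoid X (λ x → (cls y x C.≈ p) × (cls x z C.≈ q)))
                       (subSetoid X (λ x → (cls y′ x C.≈ p) × (cls x z′ C.≈ q)))

  -- hyperoperation of H(S):  r ∈ p * q  iff  a_{pq}^r ≥ 1,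
  -- i.e. y p ∩ z q* ≠ ∅ for (y , z) ∈ r (independent of the choice by regular).
  HMul : C.Carrier → C.Carrier → C.Carrier → Set (a ⊔ t)
  HMul r p q = ∃₂ λ y z → (cls y z C.≈ r) × ∃ λ x → (cls y x C.≈ p) × (cls x z C.≈ q)

-- Isomorphism between a hyperstructure presented on representatives
-- (type H, equivalence _∼_ giving the classes, membership M x a b meaning
-- "[x] ∈ [a] * [b]") and H(S): a bijection on classes preserving the
-- hyperoperation.

record HyperIso {h e m a b s t} (H : Set h) (_∼_ : Rel H e) (M : H → H → H → Set m)
                {X : Setoid a b} (S : AssociationScheme X s t)
                : Set (h ⊔ e ⊔ m ⊔ a ⊔ t ⊔ s) where
  open AssociationScheme S
  field
    f      : H → C.Carrier
    f-cong : ∀ {u v} → u ∼ v → f u C.≈ f v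
    f-inj  : ∀ {u v} → f u C.≈ f v → u ∼ v
    f-surj : ∀ r → ∃ λ u → f u C.≈ r
    f-hom  : ∀ x u v → M x u v ⇔ HMul (f x) (f u) (f v)

Realizable : ∀ {h e m} (k : Level) (H : Set h) (_∼_ : Rel H e) (M : H → H → H → Set m)
             → Set (h ⊔ e ⊔ m ⊔ suc k)
Realizable k H _∼_ M =
  Σ (Setoid k k) λ X → Σ (AssociationScheme X k k) λ S → HyperIso H _∼_ M S

module Submission where

-- (A/G, ⊕) is the hypergroup of a Schurian association scheme.
--
-- Take X = A and give the pair (x , y) the colour [y − x] ∈ A/G.  The
-- group of affine maps x ↦ g x + b (g ∈ G, b ∈ A) acts on A preserving
-- colours, and it is transitive on the pairs of each colour: if
-- z′ − y′ = g (z − y) then x ↦ g x + (y′ − g y) sends (y , z) to (y′ , z′).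
-- A general fact about colourings (module Colouring) says that a
-- colour-preserving bijection sending (y , z) to (y′ , z′) restricts to a
-- bijection between the path sets  y p ∩ z q*  and  y′ p ∩ z′ q*; hence the
-- intersection numbers are well defined and the colouring is an
-- association scheme.  The diagonal is the colour [0], and the transpose of
-- [a] is [− a].  Finally [x] ∈ [u] ⊕ [v] iff some path y → m → z has
-- colours [u], [v] and z − y ∼ x, because z − y = (m − y) + (z − m); so the
-- identity on representatives is an isomorphism A/G ≅ H(S).

open import Defs
open import Level using (Level; _⊔_; Lift; lift; lower)
open import Algebra.Bundles using (CommutativeRing)
open import Relation.Unary using (Pred)
open import Relation.Binary.Bundles using (Setoid)
open import Data.Product using (Σ; _×_; _,_; proj₁; proj₂)
open import Function.Bundles using (Inverse; mk⇔)
import Relation.Binary.Reasoning.Setoid as SetoidReasoning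

liftSetoid : ∀ {a b} (a′ b′ : Level) → Setoid a b → Setoid (a ⊔ a′) (b ⊔ b′)
liftSetoid a′ b′ S = record
  { Carrier = Lift a′ Carrier
  ; _≈_ = λ u v → Lift b′ (lower u ≈ lower v)
  ; isEquivalence = record
      { refl = lift refl
      ; sym = λ e → lift (sym (lower e))
      ; trans = λ e f → lift (trans (lower e) (lower f)) }
  }
  where open Setoid S

module Colouring {a b s t} (X : Setoid a b) (C : Setoid s t)
                 (colour : Setoid.Carrier X → Setoid.Carrier X → Setoid.Carrier C)
                 (colour-cong : ∀ {x x′ y y′} → Setoid._≈_ X x x′ → Setoid._≈_ X y y′ →
                                Setoid._≈_ C (colour x y) (colour x′ y′)) where
  open Setoid X
  private module C = Setoid C

  Paths : C.Carrier → C.Carrier → Carrier → Carrier → Setoid (a ⊔ t) b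
  Paths p q y z = subSetoid X (λ x → (colour y x C.≈ p) × (colour x z C.≈ q))

  map-paths : ∀ (φ : Carrier → Carrier) → (∀ x w → colour (φ x) (φ w) C.≈ colour x w) →
              ∀ {p q y z y′ z′} → φ y ≈ y′ → φ z ≈ z′ →
              ∀ {x} → (colour y x C.≈ p) × (colour x z C.≈ q) →
              (colour y′ (φ x) C.≈ p) × (colour (φ x) z′ C.≈ q)
  map-paths φ preserves {y = y} {z} φy≈y′ φz≈z′ {x} (yx , xz) =
      C.trans (colour-cong (sym φy≈y′) refl) (C.trans (preserves y x) yx)
    , C.trans (colour-cong refl (sym φz≈z′)) (C.trans (preserves x z) xz)

  record Automorphism : Set (a ⊔ b ⊔ t) where
    field
      to        : Carrier → Carrier
      from      : Carrier → Carrier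
      to-cong   : ∀ {x w} → x ≈ w → to x ≈ to w
      from-cong : ∀ {x w} → x ≈ w → from x ≈ from w
      to-from   : ∀ x → to (from x) ≈ x
      from-to   : ∀ x → from (to x) ≈ x
      preserves : ∀ x w → colour (to x) (to w) C.≈ colour x w

    from-preserves : ∀ x w → colour (from x) (from w) C.≈ colour x w
    from-preserves x w =
      C.trans (C.sym (preserves (from x) (from w))) (colour-cong (to-from x) (to-from w))

  transport-paths : ∀ (σ : Automorphism) {p q y z y′ z′} →
                    Automorphism.to σ y ≈ y′ → Automorphism.to σ z ≈ z′ →
                    Inverse (Paths p q y z) (Paths p q y′ z′)
  transport-paths σ {y = y} {z} {y′} {z′} σy≈y′ σz≈z′ = record
    { to        = λ { (x , path) → to x , map-paths to preserves σy≈y′ σz≈z′ path }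
    ; from      = λ { (x , path) → from x , map-paths from from-preserves τy′≈y τz′≈z path }
    ; to-cong   = to-cong
    ; from-cong = from-cong
    ; inverse   = (λ e → trans (to-cong e) (to-from _))
                , (λ e → trans (from-cong e) (from-to _))
    }
    where
    open Automorphism σ
    τy′≈y : from y′ ≈ y
    τy′≈y = trans (from-cong (sym σy≈y′)) (from-to y)
    τz′≈z : from z′ ≈ z
    τz′≈z = trans (from-cong (sym σz≈z′)) (from-to z)

module AffineScheme {c ℓ} (A : CommutativeRing c ℓ)
                    (G : Pred (CommutativeRing.Carrier A) (c ⊔ ℓ))
                    (isG : IsUnitSubgroup A G) where
  open CommutativeRing A
  open IsUnitSubgroup isG
  open QuotientHyper A G
  open SetoidReasoning setoid
  open import Algebra.Properties.Ring ring using (x[y-z]≈xy-xz; -‿distribʳ-*)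
  open import Algebra.Properties.AbelianGroup +-abelianGroup
    using ( ⁻¹-anti-homo‿-; ⁻¹-anti-homo-∙; ⁻¹-involutive; ε⁻¹≈ε
          ; x∙y⁻¹≈ε⇒x≈y; x≈y⇒x∙y⁻¹≈ε
          ; \\-leftDividesˡ; \\-leftDividesʳ; //-rightDividesˡ; //-rightDividesʳ )

  minus-zero : ∀ u → u - 0# ≈ u
  minus-zero u = trans (+-congˡ ε⁻¹≈ε) (+-identityʳ u)

  add-sub-cancelˡ : ∀ u w → (u + w) - u ≈ w
  add-sub-cancelˡ u w = trans (+-congʳ (+-comm u w)) (//-rightDividesʳ u w)

  difference-split : ∀ y m z → z - y ≈ (m - y) + (z - m)
  difference-split y m z = sym (begin
    (m - y) + (z - m)      ≈⟨ +-comm _ _ ⟩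
    (z - m) + (m - y)      ≈⟨ +-assoc z (- m) (m - y) ⟩
    z + (- m + (m - y))    ≈⟨ +-congˡ (\\-leftDividesʳ m (- y)) ⟩
    z - y                  ∎)

  unit-cancel : ∀ {g h} → h * g ≈ 1# → ∀ x → h * (g * x) ≈ x
  unit-cancel {g} {h} hg x = begin
    h * (g * x)   ≈⟨ *-assoc h g x ⟨
    (h * g) * x   ≈⟨ *-congʳ hg ⟩
    1# * x        ≈⟨ *-identityˡ x ⟩
    x             ∎

  ≈⇒∼ : ∀ {a b} → a ≈ b → a ∼ b
  ≈⇒∼ {b = b} a≈b = 1# , G-one , trans a≈b (sym (*-identityˡ b))

  ∼-refl : ∀ {a} → a ∼ a
  ∼-refl = ≈⇒∼ refl

  ∼-sym : ∀ {a b} → a ∼ b → b ∼ a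
  ∼-sym {a} {b} (g , Gg , a≈gb) with G-inv Gg
  ... | h , Gh , gh = h , Gh , sym (trans (*-congˡ a≈gb) (unit-cancel (trans (*-comm h g) gh) b))

  ∼-trans : ∀ {a b d} → a ∼ b → b ∼ d → a ∼ d
  ∼-trans {a} {b} {d} (g , Gg , a≈gb) (h , Gh , b≈hd) = g * h , G-mul Gg Gh , (begin
    a             ≈⟨ a≈gb ⟩
    g * b         ≈⟨ *-congˡ b≈hd ⟩
    g * (h * d)   ≈⟨ *-assoc g h d ⟨
    (g * h) * d   ∎)

  scale : ∀ {g a} → G g → (g * a) ∼ a
  scale {g} Gg = g , Gg , refl

  neg-∼ : ∀ {a b} → a ∼ b → (- a) ∼ (- b)
  neg-∼ {b = b} (g , Gg , a≈gb) = g , Gg , trans (-‿cong a≈gb) (-‿distribʳ-* g b)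

  ∼0⇒≈0 : ∀ {a} → a ∼ 0# → a ≈ 0#
  ∼0⇒≈0 (g , _ , a≈g0) = trans a≈g0 (zeroʳ g)

  Points : Setoid (c ⊔ ℓ) (c ⊔ ℓ)
  Points = liftSetoid ℓ c setoid

  Orbits : Setoid (c ⊔ ℓ) (c ⊔ ℓ)
  Orbits = record
    { Carrier = Lift ℓ Carrier
    ; _≈_ = λ u v → lower u ∼ lower v
    ; isEquivalence = record { refl = ∼-refl ; sym = ∼-sym ; trans = ∼-trans } }

  colour : Lift ℓ Carrier → Lift ℓ Carrier → Lift ℓ Carrier
  colour (lift x) (lift y) = lift (y - x)

  colour-cong : ∀ {x x′ y y′} → Setoid._≈_ Points x x′ → Setoid._≈_ Points y y′ →
                Setoid._≈_ Orbits (colour x y) (colour x′ y′)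
  colour-cong (lift x≈x′) (lift y≈y′) = ≈⇒∼ (+-cong y≈y′ (-‿cong x≈x′))

  open Colouring Points Orbits colour colour-cong

  affine : Carrier → Carrier → Carrier → Carrier
  affine g b x = g * x + b

  affine-difference : ∀ g b x w → affine g b w - affine g b x ≈ g * (w - x)
  affine-difference g b x w = begin
    (g * w + b) - (g * x + b)        ≈⟨ +-congˡ (⁻¹-anti-homo-∙ (g * x) b) ⟩
    (g * w + b) + (- b - g * x)      ≈⟨ +-assoc (g * w) b (- b - g * x) ⟩
    g * w + (b + (- b - g * x))      ≈⟨ +-congˡ (\\-leftDividesˡ b (- (g * x))) ⟩
    g * w - g * x                    ≈⟨ x[y-z]≈xy-xz g w x ⟨
    g * (w - x)                      ∎

  affine-inverse : ∀ {g h b b′} → h * g ≈ 1# → h * b + b′ ≈ 0# →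
                   ∀ x → affine h b′ (affine g b x) ≈ x
  affine-inverse {g} {h} {b} {b′} hg hb+b′ x = begin
    h * (g * x + b) + b′             ≈⟨ +-congʳ (distribˡ h (g * x) b) ⟩
    (h * (g * x) + h * b) + b′       ≈⟨ +-assoc (h * (g * x)) (h * b) b′ ⟩
    h * (g * x) + (h * b + b′)       ≈⟨ +-congˡ hb+b′ ⟩
    h * (g * x) + 0#                 ≈⟨ +-identityʳ _ ⟩
    h * (g * x)                      ≈⟨ unit-cancel hg x ⟩
    x                                ∎

  affine-automorphism : ∀ {g} → G g → Carrier → Automorphism
  affine-automorphism {g} Gg b = record
    { to        = λ x → lift (affine g b (lower x))
    ; from      = λ x → lift (affine h (- (h * b)) (lower x))
    ; to-cong   = λ e → lift (+-congʳ (*-congˡ (lower e)))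
    ; from-cong = λ e → lift (+-congʳ (*-congˡ (lower e)))
    ; to-from   = λ x → lift (affine-inverse gh g[-hb]+b≈0 (lower x))
    ; from-to   = λ x → lift (affine-inverse hg (-‿inverseʳ (h * b)) (lower x))
    ; preserves = λ x w → ∼-trans (≈⇒∼ (affine-difference g b (lower x) (lower w))) (scale Gg)
    }
    where
    h : Carrier
    h = proj₁ (G-inv Gg)
    gh : g * h ≈ 1#
    gh = proj₂ (proj₂ (G-inv Gg))
    hg : h * g ≈ 1#
    hg = trans (*-comm h g) gh
    g[-hb]+b≈0 : g * (- (h * b)) + b ≈ 0#
    g[-hb]+b≈0 = begin
      g * (- (h * b)) + b        ≈⟨ +-congʳ (-‿distribʳ-* g (h * b)) ⟨
      - (g * (h * b)) + b        ≈⟨ +-congʳ (-‿cong (unit-cancel gh b)) ⟩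
      - b + b                    ≈⟨ -‿inverseˡ b ⟩
      0#                         ∎

  same-colour⇒automorphism : ∀ {y z y′ z′} → Setoid._≈_ Orbits (colour y′ z′) (colour y z) →
    Σ Automorphism λ σ → Setoid._≈_ Points (Automorphism.to σ y) y′
                       × Setoid._≈_ Points (Automorphism.to σ z) z′
  same-colour⇒automorphism {lift y} {lift z} {lift y′} {lift z′} (g , Gg , e) =
    affine-automorphism Gg b , lift σy≈y′ , lift σz≈z′
    where
    b : Carrier
    b = y′ - g * y
    σy≈y′ : affine g b y ≈ y′
    σy≈y′ = trans (+-comm (g * y) b) (//-rightDividesˡ (g * y) y′)
    σz≈z′ : affine g b z ≈ z′
    σz≈z′ = begin
      affine g b z                             ≈⟨ //-rightDividesˡ (affine g b y) (affine g b z) ⟨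
      (affine g b z - affine g b y) + affine g b y ≈⟨ +-cong (affine-difference g b y z) σy≈y′ ⟩
      g * (z - y) + y′                         ≈⟨ +-congʳ e ⟨
      (z′ - y′) + y′                           ≈⟨ //-rightDividesˡ y′ z′ ⟩
      z′                                       ∎

  diagonal : ∀ x y → (y - x) ∼ 0# → x ≈ y
  diagonal x y y-x∼0 = sym (x∙y⁻¹≈ε⇒x≈y y x (∼0⇒≈0 y-x∼0))

  reverse : ∀ x y {p} → (x - y) ∼ p → (y - x) ∼ (- p)
  reverse x y x-y∼p = ∼-trans (≈⇒∼ (sym (⁻¹-anti-homo‿- x y))) (neg-∼ x-y∼p)

  scheme : AssociationScheme Points (c ⊔ ℓ) (c ⊔ ℓ)
  scheme = record
    { Cls       = Orbits
    ; point     = lift 0#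
    ; cls       = colour
    ; cls-cong  = colour-cong
    ; cls-surj  = λ r → lift 0# , r , ≈⇒∼ (minus-zero (lower r))
    ; diag      = lift 0#
    ; diag-spec = λ x y → mk⇔ (λ y-x∼0 → lift (diagonal (lower x) (lower y) y-x∼0))
                              (λ x≈y → ≈⇒∼ (x≈y⇒x∙y⁻¹≈ε (sym (lower x≈y))))
    ; star      = λ p → lift (- lower p) , λ x y →
                    mk⇔ (reverse (lower x) (lower y))
                        (λ y-x∼-p → ∼-trans (reverse (lower y) (lower x) y-x∼-p)
                                            (≈⇒∼ (⁻¹-involutive (lower p))))
    ; regular   = λ p q r y z y′ z′ yz∼r y′z′∼r →
                    let σ , σy≈y′ , σz≈z′ = same-colour⇒automorphism (∼-trans y′z′∼r (∼-sym yz∼r))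
                    in transport-paths σ σy≈y′ σz≈z′
    }

  isomorphism : HyperIso Carrier _∼_ HAdd scheme
  isomorphism = record
    { f      = lift
    ; f-cong = λ u∼v → u∼v
    ; f-inj  = λ u∼v → u∼v
    ; f-surj = λ r → lower r , ∼-refl
    ; f-hom  = λ x u v → mk⇔ (sum⇒path x u v) (path⇒sum x u v)
    }
    where
    open AssociationScheme scheme using (HMul)

    sum⇒path : ∀ x u v → HAdd x u v → HMul (lift x) (lift u) (lift v)
    sum⇒path x u v (g₁ , g₂ , Gg₁ , Gg₂ , x∼sum) =
        lift 0# , lift (g₁ * u + g₂ * v) , ∼-trans (≈⇒∼ (minus-zero _)) (∼-sym x∼sum)
      , lift (g₁ * u) , ∼-trans (≈⇒∼ (minus-zero _)) (scale Gg₁)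
                      , ∼-trans (≈⇒∼ (add-sub-cancelˡ (g₁ * u) (g₂ * v))) (scale Gg₂)

    path⇒sum : ∀ x u v → HMul (lift x) (lift u) (lift v) → HAdd x u v
    path⇒sum x u v (lift y , lift z , z-y∼x , lift m , (h , Gh , m-y≈hu) , (k , Gk , z-m≈kv)) =
      h , k , Gh , Gk , ∼-trans (∼-sym z-y∼x)
                          (≈⇒∼ (trans (difference-split y m z) (+-cong m-y≈hu z-m≈kv)))

proposition5p14 : ∀ {c ℓ} (A : CommutativeRing c ℓ)
                    (G : Pred (CommutativeRing.Carrier A) (c ⊔ ℓ)) →
                    IsUnitSubgroup A G →
                    Realizable (c ⊔ ℓ) (CommutativeRing.Carrier A)
                      (QuotientHyper._∼_ A G) (QuotientHyper.HAdd A G)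
proposition5p14 A G isG = Points , scheme , isomorphism
  where open AffineScheme A G isG
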